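{- For any prime power $q$, the minimum eigenvalue of the adjacency matrix of $\varOmega_q^{(\mathbb{F}_q)}$ is $-\frac{q!}{q-1}$.
   Context: $\varOmega_q^{(\mathbb{F}_q)}$ has vertex set $\mathbb{F}_q^q$, and $x,y$ are adjacent iff every element of $\mathbb{F}_q$ appears exactly once among the coordinates of $y-x$. -}

module Defs where

open import Level using (Level; _⊔_) renaming (suc to lsuc)
open import Data.Nat as ℕ using (ℕ; zero; suc; _∸_; _≡ᵇ_)
open import Data.Fin using (Fin; toℕ)
open import Data.Bool using (Bool; true; false; if_then_else_)
open import Data.Bool.ListAction using (and)
open import Data.List as List using (List; []; _∷_; [_]; concatMap)
open import Data.Vec as Vec using (Vec; zipWith; count)
open import Data.Product using (Σ; ∃; _×_; _,_)
open import Relation.Nullary using (¬_)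
open import Relation.Binary using (Rel; IsTotalOrder; DecidableEquality)
open import Relation.Binary.PropositionalEquality using (_≡_; _≢_)
open import Algebra.Bundles using (CommutativeRing)
open import Algebra.Structures using (IsCommutativeRing)

record FiniteField (f : Level) : Set (lsuc f) where
  infixl 7 _*_
  infixl 6 _+_
  field
    Carrier : Set f
    _+_ _*_ : Carrier → Carrier → Carrier
    -_ : Carrier → Carrier
    0# 1# : Carrier
    isCommutativeRing : IsCommutativeRing _≡_ _+_ _*_ -_ 0# 1#
    0≢1 : 0# ≢ 1#
    inverse : ∀ x → x ≢ 0# → ∃ λ y → x * y ≡ 1#
    _≟_ : DecidableEquality Carrier
    size : ℕ
    enum : Fin size → Carrier
    enum-injective : ∀ i j → enum i ≡ enum j → i ≡ j
    enum-surjective : ∀ a → ∃ λ i → enum i ≡ a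

  elements : List Carrier
  elements = List.map enum (List.allFin size)

-- Real closed fields (the eigenvalues of a real symmetric matrix live in
-- any real closed field, e.g. ℝ; there are no reals in agda-stdlib).

module _ {c ℓ} (R : CommutativeRing c ℓ) where
  open CommutativeRing R

  pow : Carrier → ℕ → Carrier
  pow x zero    = 1#
  pow x (suc n) = x * pow x n

  sumFin : (n : ℕ) → (Fin n → Carrier) → Carrier
  sumFin zero    f = 0#
  sumFin (suc n) f = f Fin.zero + sumFin n (λ i → f (Fin.suc i))

  evalMonic : (n : ℕ) → (Fin n → Carrier) → Carrier → Carrier
  evalMonic n a x = pow x n + sumFin n (λ i → a i * pow x (toℕ i))

record RealClosedField (c ℓ : Level) : Set (lsuc (c ⊔ ℓ)) where
  field
    commutativeRing : CommutativeRing c ℓ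
  open CommutativeRing commutativeRing public
  field
    _≤_ : Rel Carrier ℓ
    isTotalOrder : IsTotalOrder _≈_ _≤_
    +-mono-≤ : ∀ {x y} z → x ≤ y → (x + z) ≤ (y + z)
    *-nonneg : ∀ {x y} → 0# ≤ x → 0# ≤ y → 0# ≤ (x * y)
    0≉1 : ¬ (0# ≈ 1#)
    inverse : ∀ x → ¬ (x ≈ 0#) → ∃ λ y → (x * y) ≈ 1#
    sqrt : ∀ x → 0# ≤ x → ∃ λ y → (y * y) ≈ x
    oddRoot : ∀ k (a : Fin (suc (2 ℕ.* k)) → Carrier) →
              ∃ λ x → evalMonic commutativeRing (suc (2 ℕ.* k)) a x ≈ 0#

  fromℕ : ℕ → Carrier
  fromℕ zero    = 0#
  fromℕ (suc n) = 1# + fromℕ n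

  sumList : ∀ {a} {A : Set a} → List A → (A → Carrier) → Carrier
  sumList []       f = 0#
  sumList (x ∷ xs) f = f x + sumList xs f

-- The graph Ω_q^{(F_q)}: vertex set F_q^q, x ~ y iff every element of
-- F_q appears exactly once among the coordinates of y - x.

allVecs : ∀ {a} {A : Set a} (n : ℕ) → List A → List (Vec A n)
allVecs zero    xs = [ Vec.[] ]
allVecs (suc n) xs = concatMap (λ a → List.map (a Vec.∷_) (allVecs n xs)) xs

module Omega {f} (F : FiniteField f) where
  open FiniteField F using (size; elements; _≟_)
    renaming (Carrier to 𝔽; _+_ to _+𝔽_; -_ to -𝔽_)

  q : ℕ
  q = size

  Vertex : Set f
  Vertex = Vec 𝔽 q

  vertices : List Vertex
  vertices = allVecs q elements

  _-ᵥ_ : Vertex → Vertex → Vertex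
  y -ᵥ x = zipWith (λ b a → b +𝔽 (-𝔽 a)) y x

  adjacent : Vertex → Vertex → Bool
  adjacent x y = and (List.map (λ a → count (a ≟_) (y -ᵥ x) ≡ᵇ 1) elements)

  module _ {c ℓ} (R : RealClosedField c ℓ) where
    open RealClosedField R

    A : Vertex → Vertex → Carrier
    A x y = if adjacent x y then 1# else 0#

    IsEigenvalue : Carrier → Set (f ⊔ c ⊔ ℓ)
    IsEigenvalue λ′ = Σ (Vertex → Carrier) λ v →
      (∃ λ x → ¬ (v x ≈ 0#)) ×
      (∀ x → sumList vertices (λ y → A x y * v y) ≈ (λ′ * v x))

    IsMinEigenvalue : Carrier → Set (f ⊔ c ⊔ ℓ)
    IsMinEigenvalue λ′ = IsEigenvalue λ′ × (∀ μ → IsEigenvalue μ → λ′ ≤ μ)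

-- Ω_q is the Cayley graph on F_q^q whose connection set S consists of the vectors listing every
-- element of F_q exactly once; |S| = q!, and S is closed under multiplication by nonzero scalars.
--
-- Lower bound: if A v = μ v, sum the squares of the line sums Σ_{c ∈ F_q} v (x + c σ) over all
-- x ∈ F_q^q and σ ∈ S.  The cross terms with c ≠ d involve the direction (d - c) σ, which again
-- runs over S, so they contribute μ ‖v‖²; the total is q ‖v‖² (q! + (q - 1) μ) ≥ 0, whence
-- μ ≥ -q!/(q - 1).
--
-- Sharpness: S misses the kernel of φ σ = σ_i - σ_j (i ≠ j) and, by scaling, meets each other
-- level set of φ in the same number q!/(q - 1) of points.  Hence y ↦ q [φ y = 0] - 1 is an
-- eigenvector with eigenvalue -q!/(q - 1).

module Submission where

open import Defs
open import Algebra.Bundles using (CommutativeRing)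
open import Data.Bool using (Bool; true; false; if_then_else_; T)
open import Data.Bool.ListAction using (and; all)
open import Data.Empty using (⊥-elim)
open import Data.Fin as Fin using (Fin; zero; suc)
import Data.Fin.Properties as Fin
open import Data.List as List using (List; []; _∷_)
import Data.List.Properties as List
open import Data.List.Membership.Propositional using (_∈_)
open import Data.List.Relation.Unary.Any using (here; there)
import Data.List.Relation.Unary.All as All
import Data.List.Relation.Unary.All.Properties as All
open import Data.Nat as ℕ using (ℕ; zero; suc; _∸_; _!; _≡ᵇ_)
import Data.Nat.Properties as ℕ
open import Data.Nat.ListAction using () renaming (sum to sumℕ)
open import Data.Product using (Σ; ∃; _×_; _,_; proj₁; proj₂)
open import Data.Sum using (inj₁; inj₂; [_,_]′)
open import Data.Vec as Vec using (Vec; []; _∷_)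
import Data.Vec.Properties as Vec
open import Function using (id; _∘_; _⇔_; Equivalence; mk⇔)
open import Function.Definitions using (Injective)
open import Relation.Binary using (Rel; IsTotalOrder; DecidableEquality)
open import Relation.Binary.PropositionalEquality as ≡ using (_≡_; _≢_)
open import Relation.Nullary using (does; yes; no)
open import Relation.Nullary.Decidable using (toSum)
open import Relation.Unary using (Pred; Decidable)

module OrderedField {c ℓ} (R : RealClosedField c ℓ) where
  -- The record field has no fixity declaration; this copy gets the usual one.
  infix 4 _≤_
  _≤_ : Rel (RealClosedField.Carrier R) ℓ
  _≤_ = RealClosedField._≤_ R

  open RealClosedField R hiding (_≤_)
  open IsTotalOrder isTotalOrder using (total; antisym)
    renaming (refl to ≤-refl; trans to ≤-trans; reflexive to ≤-reflexive)
  open import Algebra.Properties.Ring ring using (-‿distribˡ-*; -‿distribʳ-*; -‿involutive)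
  open import Algebra.Properties.AbelianGroup +-abelianGroup using (xyx⁻¹≈y)
  open import Relation.Binary.Reasoning.Setoid setoid

  ≤-resp-≈ : ∀ {x x′ y y′} → x ≈ x′ → y ≈ y′ → x ≤ y → x′ ≤ y′
  ≤-resp-≈ x≈x′ y≈y′ x≤y = ≤-trans (≤-reflexive (sym x≈x′)) (≤-trans x≤y (≤-reflexive y≈y′))

  x≤x+y : ∀ {y} x → 0# ≤ y → x ≤ x + y
  x≤x+y {y} x 0≤y = ≤-resp-≈ (+-identityˡ x) (+-comm y x) (+-mono-≤ x 0≤y)

  ≤0⇒0≤- : ∀ {x} → x ≤ 0# → 0# ≤ - x
  ≤0⇒0≤- {x} x≤0 = ≤-resp-≈ (-‿inverseʳ x) (+-identityˡ (- x)) (+-mono-≤ (- x) x≤0)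

  0≤x+y⇒-x≤y : ∀ {x y} → 0# ≤ x + y → - x ≤ y
  0≤x+y⇒-x≤y {x} {y} 0≤x+y = ≤-resp-≈ (+-identityˡ (- x)) (xyx⁻¹≈y x y) (+-mono-≤ (- x) 0≤x+y)

  +-nonneg : ∀ {x y} → 0# ≤ x → 0# ≤ y → 0# ≤ x + y
  +-nonneg {x} 0≤x 0≤y = ≤-trans 0≤x (x≤x+y x 0≤y)

  -x*-y≈x*y : ∀ x y → - x * - y ≈ x * y
  -x*-y≈x*y x y = begin
    - x * - y    ≈⟨ -‿distribˡ-* x (- y) ⟨
    - (x * - y)  ≈⟨ -‿cong (-‿distribʳ-* x y) ⟨
    - - (x * y)  ≈⟨ -‿involutive (x * y) ⟩
    x * y        ∎

  square-nonneg : ∀ x → 0# ≤ x * x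
  square-nonneg x with total 0# x
  ... | inj₁ 0≤x = *-nonneg 0≤x 0≤x
  ... | inj₂ x≤0 = ≤-resp-≈ refl (-x*-y≈x*y x x) (*-nonneg (≤0⇒0≤- x≤0) (≤0⇒0≤- x≤0))

  0≤1 : 0# ≤ 1#
  0≤1 = ≤-resp-≈ refl (*-identityˡ 1#) (square-nonneg 1#)

  fromℕ-nonneg : ∀ n → 0# ≤ fromℕ n
  fromℕ-nonneg zero    = ≤-refl
  fromℕ-nonneg (suc n) = +-nonneg 0≤1 (fromℕ-nonneg n)

  nonneg-sum≈0⇒≈0 : ∀ {x y} → 0# ≤ x → 0# ≤ y → x + y ≈ 0# → x ≈ 0#
  nonneg-sum≈0⇒≈0 {x} 0≤x 0≤y x+y≈0 = antisym (≤-resp-≈ refl x+y≈0 (x≤x+y x 0≤y)) 0≤x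

  fromℕ-suc≉0 : ∀ n → fromℕ (suc n) ≉ 0#
  fromℕ-suc≉0 n 1+n≈0 = 0≉1 (sym (nonneg-sum≈0⇒≈0 0≤1 (fromℕ-nonneg n) 1+n≈0))

  fromℕ-+ : ∀ m n → fromℕ (m ℕ.+ n) ≈ fromℕ m + fromℕ n
  fromℕ-+ zero    n = sym (+-identityˡ _)
  fromℕ-+ (suc m) n = trans (+-congˡ (fromℕ-+ m n)) (sym (+-assoc _ _ _))

  fromℕ-* : ∀ m n → fromℕ (m ℕ.* n) ≈ fromℕ m * fromℕ n
  fromℕ-* zero    n = sym (zeroˡ _)
  fromℕ-* (suc m) n = begin
    fromℕ (n ℕ.+ m ℕ.* n)             ≈⟨ fromℕ-+ n (m ℕ.* n) ⟩
    fromℕ n + fromℕ (m ℕ.* n)         ≈⟨ +-congˡ (fromℕ-* m n) ⟩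
    fromℕ n + fromℕ m * fromℕ n       ≈⟨ +-congʳ (*-identityˡ (fromℕ n)) ⟨
    1# * fromℕ n + fromℕ m * fromℕ n  ≈⟨ distribʳ (fromℕ n) 1# (fromℕ m) ⟨
    (1# + fromℕ m) * fromℕ n          ∎

  *-cancelˡ : ∀ {a x y} → a ≉ 0# → a * x ≈ a * y → x ≈ y
  *-cancelˡ {a} {x} {y} a≉0 ax≈ay with inverse a a≉0
  ... | a⁻¹ , aa⁻¹≈1 = begin
    x                ≈⟨ unit x ⟨
    a⁻¹ * (a * x)    ≈⟨ *-congˡ ax≈ay ⟩
    a⁻¹ * (a * y)    ≈⟨ unit y ⟩
    y                ∎
    where
    unit : ∀ z → a⁻¹ * (a * z) ≈ z
    unit z = trans (sym (*-assoc _ _ _)) (trans (*-congʳ (trans (*-comm a⁻¹ a) aa⁻¹≈1)) (*-identityˡ z))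

  *-≉0 : ∀ {x y} → x ≉ 0# → y ≉ 0# → x * y ≉ 0#
  *-≉0 {x} x≉0 y≉0 xy≈0 = y≉0 (*-cancelˡ x≉0 (trans xy≈0 (sym (zeroʳ x))))

  square-≉0 : ∀ {x} → x ≉ 0# → x * x ≉ 0#
  square-≉0 x≉0 = *-≉0 x≉0 x≉0

  nonneg-*-cancelˡ : ∀ {p y} → 0# ≤ p → p ≉ 0# → 0# ≤ p * y → 0# ≤ y
  nonneg-*-cancelˡ {p} {y} 0≤p p≉0 0≤py with total 0# y
  ... | inj₁ 0≤y = 0≤y
  ... | inj₂ y≤0 = ≤-reflexive (sym (*-cancelˡ p≉0 (trans py≈0 (sym (zeroʳ p)))))
    where
    0≤-py : 0# ≤ - (p * y)
    0≤-py = ≤-resp-≈ refl (sym (-‿distribʳ-* p y)) (*-nonneg 0≤p (≤0⇒0≤- y≤0))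
    py≈0 : p * y ≈ 0#
    py≈0 = nonneg-sum≈0⇒≈0 0≤py 0≤-py (-‿inverseʳ (p * y))

module Occurrences {a} {A : Set a} (_≟_ : DecidableEquality A) where

  occ : A → List A → ℕ
  occ x []       = 0
  occ x (y ∷ ys) = if does (y ≟ x) then suc (occ x ys) else occ x ys

  Enumerates : List A → Set a
  Enumerates xs = ∀ x → occ x xs ≡ 1

  occ-++ : ∀ x xs ys → occ x (xs List.++ ys) ≡ occ x xs ℕ.+ occ x ys
  occ-++ x []       ys = ≡.refl
  occ-++ x (y ∷ xs) ys with does (y ≟ x)
  ... | true  = ≡.cong suc (occ-++ x xs ys)
  ... | false = occ-++ x xs ys

  occ≢0⇒∈ : ∀ {x} xs → occ x xs ≢ 0 → x ∈ xs
  occ≢0⇒∈ {x} []       occ≢0 = ⊥-elim (occ≢0 ≡.refl)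
  occ≢0⇒∈ {x} (y ∷ xs) occ≢0 with y ≟ x
  ... | yes ≡.refl = here ≡.refl
  ... | no  _      = there (occ≢0⇒∈ xs occ≢0)

  enumerates⇒∈ : ∀ {xs} → Enumerates xs → ∀ x → x ∈ xs
  enumerates⇒∈ {xs} en x = occ≢0⇒∈ xs (λ occ≡0 → ℕ.1+n≢0 (≡.trans (≡.sym (en x)) occ≡0))

module _ {a b} {A : Set a} {B : Set b} (_≟A_ : DecidableEquality A) (_≟B_ : DecidableEquality B) where
  open Occurrences _≟A_ renaming (occ to occA)
  open Occurrences _≟B_ renaming (occ to occB)

  occ-map-injective : ∀ {f : A → B} → Injective _≡_ _≡_ f → ∀ x xs → occB (f x) (List.map f xs) ≡ occA x xs
  occ-map-injective f-inj x []       = ≡.refl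
  occ-map-injective {f} f-inj x (y ∷ xs) with f y ≟B f x | y ≟A x
  ... | yes _   | yes _    = ≡.cong suc (occ-map-injective f-inj x xs)
  ... | no  _   | no  _    = occ-map-injective f-inj x xs
  ... | yes fy≡fx | no y≢x = ⊥-elim (y≢x (f-inj fy≡fx))
  ... | no fy≢fx | yes ≡.refl = ⊥-elim (fy≢fx ≡.refl)

  occ-map-∉-image : ∀ (f : A → B) {z} → (∀ x → f x ≢ z) → ∀ xs → occB z (List.map f xs) ≡ 0
  occ-map-∉-image f z∉im []       = ≡.refl
  occ-map-∉-image f {z} z∉im (y ∷ xs) with f y ≟B z
  ... | yes fy≡z = ⊥-elim (z∉im y fy≡z)
  ... | no  _    = occ-map-∉-image f z∉im xs

allFin-suc : ∀ n → List.allFin (suc n) ≡ zero ∷ List.map suc (List.allFin n)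
allFin-suc n = ≡.cong (zero ∷_) (≡.sym (List.map-tabulate id suc))

allFin-enumerates : ∀ n → Occurrences.Enumerates Fin._≟_ (List.allFin n)
allFin-enumerates (suc n) i = ≡.subst (λ is → occ i is ≡ 1) (≡.sym (allFin-suc n)) (occ-suc i)
  where
  open Occurrences Fin._≟_
  occ-suc : ∀ i → occ i (zero ∷ List.map suc (List.allFin n)) ≡ 1
  occ-suc zero    = ≡.cong suc (occ-map-∉-image Fin._≟_ Fin._≟_ suc (λ _ ()) (List.allFin n))
  occ-suc (suc j) = ≡.trans (occ-map-injective Fin._≟_ Fin._≟_ Fin.suc-injective j (List.allFin n))
                          (allFin-enumerates n j)

module _ {a} {A : Set a} (_≟_ : DecidableEquality A) where
  open Occurrences _≟_
  private
    module OccVec {n} = Occurrences (Vec.≡-dec {n = n} _≟_)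

  occ-∷-concatMap : ∀ {n} b (w : Vec A n) (es : List A) (ws : List (Vec A n)) →
    OccVec.occ (b ∷ w) (List.concatMap (λ a → List.map (a ∷_) ws) es) ≡ occ b es ℕ.* OccVec.occ w ws
  occ-∷-concatMap b w []       ws = ≡.refl
  occ-∷-concatMap b w (a ∷ es) ws
    rewrite OccVec.occ-++ (b ∷ w) (List.map (a ∷_) ws) (List.concatMap (λ a → List.map (a ∷_) ws) es)
          | occ-∷-concatMap b w es ws
    with a ≟ b
  ... | yes ≡.refl = ≡.cong (ℕ._+ occ b es ℕ.* OccVec.occ w ws)
                            (occ-map-injective (Vec.≡-dec _≟_) (Vec.≡-dec _≟_) Vec.∷-injectiveʳ w ws)
  ... | no  a≢b    = ≡.cong (ℕ._+ occ b es ℕ.* OccVec.occ w ws)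
                            (occ-map-∉-image (Vec.≡-dec _≟_) (Vec.≡-dec _≟_) (a ∷_) (λ _ → a≢b ∘ Vec.∷-injectiveˡ) ws)

  allVecs-enumerates : ∀ {es} → Enumerates es → ∀ n → OccVec.Enumerates (allVecs n es)
  allVecs-enumerates en zero    []      = ≡.refl
  allVecs-enumerates {es} en (suc n) (b ∷ w) = begin
    OccVec.occ (b ∷ w) (allVecs (suc n) es)    ≡⟨ occ-∷-concatMap b w es (allVecs n es) ⟩
    occ b es ℕ.* OccVec.occ w (allVecs n es)   ≡⟨ ≡.cong₂ ℕ._*_ (en b) (allVecs-enumerates en n w) ⟩
    1                                          ∎
    where open ≡.≡-Reasoning

all-∈-false : ∀ {b} {B : Set b} (p : B → Bool) {x xs} → x ∈ xs → p x ≡ false → all p xs ≡ false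
all-∈-false p (here ≡.refl) px≡false rewrite px≡false = ≡.refl
all-∈-false p {xs = y ∷ _} (there x∈xs) px≡false with p y
... | true  = all-∈-false p x∈xs px≡false
... | false = ≡.refl

sumℕ-map-1 : ∀ {a} {A : Set a} (xs : List A) → sumℕ (List.map (λ _ → 1) xs) ≡ List.length xs
sumℕ-map-1 []       = ≡.refl
sumℕ-map-1 (x ∷ xs) = ≡.cong suc (sumℕ-map-1 xs)

T-⇔⇒≡ : ∀ {b b′} → T b ⇔ T b′ → b ≡ b′
T-⇔⇒≡ {false} {false} _ = ≡.refl
T-⇔⇒≡ {false} {true}  b⇔b′ = ⊥-elim (Equivalence.from b⇔b′ _)
T-⇔⇒≡ {true}  {false} b⇔b′ = ⊥-elim (Equivalence.to b⇔b′ _)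
T-⇔⇒≡ {true}  {true}  _ = ≡.refl

module _ {a p q} {A : Set a} {P : Pred A p} {Q : Pred A q} (P? : Decidable P) (Q? : Decidable Q) where

  count-map-⇔ : ∀ (f : A → A) → (∀ x → P (f x) ⇔ Q x) → ∀ {n} (v : Vec A n) →
                Vec.count P? (Vec.map f v) ≡ Vec.count Q? v
  count-map-⇔ f Pf⇔Q []      = ≡.refl
  count-map-⇔ f Pf⇔Q (x ∷ v) with P? (f x) | Q? x
  ... | yes _   | yes _  = ≡.cong suc (count-map-⇔ f Pf⇔Q v)
  ... | no  _   | no  _  = count-map-⇔ f Pf⇔Q v
  ... | yes Pfx | no ¬Qx = ⊥-elim (¬Qx (Equivalence.to (Pf⇔Q x) Pfx))
  ... | no ¬Pfx | yes Qx = ⊥-elim (¬Pfx (Equivalence.from (Pf⇔Q x) Qx))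

module _ {a p} {A : Set a} {P : Pred A p} (P? : Decidable P) where

  count≥1 : ∀ {n} (v : Vec A n) i → P (Vec.lookup v i) → 1 ℕ.≤ Vec.count P? v
  count≥1 (x ∷ v) i Pvᵢ with P? x | i
  ... | yes _  | _     = ℕ.s≤s ℕ.z≤n
  ... | no ¬Px | zero  = ⊥-elim (¬Px Pvᵢ)
  ... | no _   | suc i = count≥1 v i Pvᵢ

  count≥2 : ∀ {n} (v : Vec A n) {i j} → i ≢ j → P (Vec.lookup v i) → P (Vec.lookup v j) →
            2 ℕ.≤ Vec.count P? v
  count≥2 (x ∷ v) {i} {j} i≢j Pvᵢ Pvⱼ with P? x | i | j
  ... | _      | zero  | zero  = ⊥-elim (i≢j ≡.refl)
  ... | yes _  | zero  | suc j = ℕ.s≤s (count≥1 v j Pvⱼ)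
  ... | yes _  | suc i | zero  = ℕ.s≤s (count≥1 v i Pvᵢ)
  ... | yes _  | suc i | suc j = ℕ.s≤s (count≥1 v i Pvᵢ)
  ... | no ¬Px | zero  | _     = ⊥-elim (¬Px Pvᵢ)
  ... | no ¬Px | suc _ | zero  = ⊥-elim (¬Px Pvⱼ)
  ... | no _   | suc i | suc j = count≥2 v (i≢j ∘ ≡.cong suc) Pvᵢ Pvⱼ

[n∸1]*[n*[n∸2]!]≡n! : ∀ {n} → 2 ℕ.≤ n → (n ∸ 1) ℕ.* (n ℕ.* (n ∸ 2) !) ≡ n !
[n∸1]*[n*[n∸2]!]≡n! {suc (suc r)} (ℕ.s≤s (ℕ.s≤s _)) = x∙yz≈y∙xz (suc r) (suc (suc r)) (r !)
  where open import Algebra.Properties.CommutativeSemigroup ℕ.*-commutativeSemigroup using (x∙yz≈y∙xz)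

module FiniteSums {c ℓ} (R : RealClosedField c ℓ) where
  open RealClosedField R hiding (_≤_)
  open OrderedField R
  open import Algebra.Properties.AbelianGroup +-abelianGroup using (⁻¹-∙-comm; ε⁻¹≈ε)
  open import Relation.Binary.Reasoning.Setoid setoid
  open import Algebra.Properties.CommutativeSemigroup +-commutativeSemigroup using (interchange)

  ι : Bool → Carrier
  ι b = if b then 1# else 0#

  ι-nonneg : ∀ b → 0# ≤ ι b
  ι-nonneg true  = 0≤1
  ι-nonneg false = IsTotalOrder.refl isTotalOrder

  module _ {a} {A : Set a} where

    sum-cong : ∀ (xs : List A) {f g : A → Carrier} → (∀ x → f x ≈ g x) → sumList xs f ≈ sumList xs g
    sum-cong []       f≈g = refl
    sum-cong (x ∷ xs) f≈g = +-cong (f≈g x) (sum-cong xs f≈g)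

    sum-distrib-+ : ∀ (xs : List A) (f g : A → Carrier) →
                    sumList xs (λ x → f x + g x) ≈ sumList xs f + sumList xs g
    sum-distrib-+ []       f g = sym (+-identityˡ 0#)
    sum-distrib-+ (x ∷ xs) f g = trans (+-congˡ (sum-distrib-+ xs f g)) (interchange (f x) (g x) _ _)

    *-distribˡ-sum : ∀ (xs : List A) k (f : A → Carrier) → k * sumList xs f ≈ sumList xs (λ x → k * f x)
    *-distribˡ-sum []       k f = zeroʳ k
    *-distribˡ-sum (x ∷ xs) k f = trans (distribˡ k _ _) (+-congˡ (*-distribˡ-sum xs k f))

    *-distribʳ-sum : ∀ (xs : List A) k (f : A → Carrier) → sumList xs f * k ≈ sumList xs (λ x → f x * k)
    *-distribʳ-sum xs k f = trans (*-comm _ k) (trans (*-distribˡ-sum xs k f) (sum-cong xs (λ x → *-comm k (f x))))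

    sum-zero : ∀ (xs : List A) → sumList xs (λ _ → 0#) ≈ 0#
    sum-zero []       = refl
    sum-zero (x ∷ xs) = trans (+-identityˡ _) (sum-zero xs)

    -‿distrib-sum : ∀ (xs : List A) (f : A → Carrier) → - sumList xs f ≈ sumList xs (λ x → - f x)
    -‿distrib-sum []       f = ε⁻¹≈ε
    -‿distrib-sum (x ∷ xs) f = trans (sym (⁻¹-∙-comm _ _)) (+-congˡ (-‿distrib-sum xs f))

    sum-const : ∀ (xs : List A) k → sumList xs (λ _ → k) ≈ fromℕ (List.length xs) * k
    sum-const []       k = sym (zeroˡ k)
    sum-const (x ∷ xs) k = begin
      k + sumList xs (λ _ → k)          ≈⟨ +-cong (sym (*-identityˡ k)) (sum-const xs k) ⟩
      1# * k + fromℕ (List.length xs) * k ≈⟨ distribʳ k 1# _ ⟨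
      (1# + fromℕ (List.length xs)) * k ∎

    sum-++ : ∀ (xs ys : List A) (f : A → Carrier) → sumList (xs List.++ ys) f ≈ sumList xs f + sumList ys f
    sum-++ []       ys f = sym (+-identityˡ _)
    sum-++ (x ∷ xs) ys f = trans (+-congˡ (sum-++ xs ys f)) (sym (+-assoc _ _ _))

    sum-fromℕ : ∀ (xs : List A) (m : A → ℕ) → sumList xs (fromℕ ∘ m) ≈ fromℕ (sumℕ (List.map m xs))
    sum-fromℕ []       m = refl
    sum-fromℕ (x ∷ xs) m = trans (+-congˡ (sum-fromℕ xs m)) (sym (fromℕ-+ (m x) _))

    sum-nonneg : ∀ (xs : List A) {f : A → Carrier} → (∀ x → 0# ≤ f x) → 0# ≤ sumList xs f
    sum-nonneg []       0≤f = IsTotalOrder.refl isTotalOrder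
    sum-nonneg (x ∷ xs) 0≤f = +-nonneg (0≤f x) (sum-nonneg xs 0≤f)

    nonneg-sum-≉0 : ∀ {xs : List A} {f : A → Carrier} {x} → x ∈ xs → (∀ y → 0# ≤ f y) → f x ≉ 0# →
                    sumList xs f ≉ 0#
    nonneg-sum-≉0 {y ∷ ys} (here ≡.refl) 0≤f fx≉0 =
      fx≉0 ∘ nonneg-sum≈0⇒≈0 (0≤f y) (sum-nonneg ys 0≤f)
    nonneg-sum-≉0 {y ∷ ys} (there x∈ys) 0≤f fx≉0 =
      nonneg-sum-≉0 x∈ys 0≤f fx≉0 ∘ nonneg-sum≈0⇒≈0 (sum-nonneg ys 0≤f) (0≤f y) ∘ trans (+-comm _ _)

  module _ {a b} {A : Set a} {B : Set b} where

    sum-comm : ∀ (xs : List A) (ys : List B) (f : A → B → Carrier) →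
               sumList xs (λ x → sumList ys (f x)) ≈ sumList ys (λ y → sumList xs (λ x → f x y))
    sum-comm []       ys f = sym (sum-zero ys)
    sum-comm (x ∷ xs) ys f =
      trans (+-congˡ (sum-comm xs ys f)) (sym (sum-distrib-+ ys (f x) (λ y → sumList xs (λ x → f x y))))

    sum-map : ∀ (g : A → B) (xs : List A) (f : B → Carrier) → sumList (List.map g xs) f ≈ sumList xs (f ∘ g)
    sum-map g []       f = refl
    sum-map g (x ∷ xs) f = +-congˡ (sum-map g xs f)

    sum-concatMap : ∀ (g : A → List B) (xs : List A) (f : B → Carrier) →
                    sumList (List.concatMap g xs) f ≈ sumList xs (λ x → sumList (g x) f)
    sum-concatMap g []       f = refl
    sum-concatMap g (x ∷ xs) f = trans (sum-++ (g x) (List.concatMap g xs) f) (+-congˡ (sum-concatMap g xs f))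

    sum-*-sum : ∀ (xs : List A) (ys : List B) (f : A → Carrier) (g : B → Carrier) →
                sumList xs f * sumList ys g ≈ sumList xs (λ x → sumList ys (λ y → f x * g y))
    sum-*-sum xs ys f g = trans (*-distribʳ-sum xs _ f) (sum-cong xs (λ x → *-distribˡ-sum ys (f x) g))

  module _ {a b c d} {A : Set a} {B : Set b} {C : Set c} {D : Set d} where

    sum-comm-pairs : ∀ (as : List A) (bs : List B) (cs : List C) (ds : List D) (f : A → B → C → D → Carrier) →
      sumList as (λ a → sumList bs (λ b → sumList cs (λ c → sumList ds (f a b c)))) ≈
      sumList cs (λ c → sumList ds (λ d → sumList as (λ a → sumList bs (λ b → f a b c d))))
    sum-comm-pairs as bs cs ds f = begin
      sumList as (λ a → sumList bs (λ b → sumList cs (λ c → sumList ds (f a b c))))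
        ≈⟨ sum-cong as (λ a → sum-comm bs cs (λ b c → sumList ds (f a b c))) ⟩
      sumList as (λ a → sumList cs (λ c → sumList bs (λ b → sumList ds (f a b c))))
        ≈⟨ sum-comm as cs _ ⟩
      sumList cs (λ c → sumList as (λ a → sumList bs (λ b → sumList ds (f a b c))))
        ≈⟨ sum-cong cs (λ c → sum-cong as (λ a → sum-comm bs ds (λ b → f a b c))) ⟩
      sumList cs (λ c → sumList as (λ a → sumList ds (λ d → sumList bs (λ b → f a b c d))))
        ≈⟨ sum-cong cs (λ c → sum-comm as ds _) ⟩
      sumList cs (λ c → sumList ds (λ d → sumList as (λ a → sumList bs (λ b → f a b c d)))) ∎

  module Indicator {a} {A : Set a} (_≟_ : DecidableEquality A) where
    open Occurrences _≟_

    δ : A → A → Carrier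
    δ x y = ι (does (x ≟ y))

    δ-refl : ∀ x → δ x x ≡ 1#
    δ-refl x with x ≟ x
    ... | yes _   = ≡.refl
    ... | no  x≢x = ⊥-elim (x≢x ≡.refl)

    δ-≢ : ∀ {x y} → x ≢ y → δ x y ≡ 0#
    δ-≢ {x} {y} x≢y with x ≟ y
    ... | yes x≡y = ⊥-elim (x≢y x≡y)
    ... | no  _   = ≡.refl

    δ-cong-⇔ : ∀ {x y x′ y′} → (x ≡ y → x′ ≡ y′) → (x′ ≡ y′ → x ≡ y) → δ x y ≡ δ x′ y′
    δ-cong-⇔ {x} {y} {x′} {y′} to from with x ≟ y | x′ ≟ y′
    ... | yes _   | yes _     = ≡.refl
    ... | no  _   | no  _     = ≡.refl
    ... | yes x≡y | no  x′≢y′ = ⊥-elim (x′≢y′ (to x≡y))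
    ... | no  x≢y | yes x′≡y′ = ⊥-elim (x≢y (from x′≡y′))

    δ-sym : ∀ x y → δ x y ≡ δ y x
    δ-sym x y = δ-cong-⇔ ≡.sym ≡.sym

    sum-δ : ∀ (xs : List A) a (h : A → Carrier) → sumList xs (λ y → δ y a * h y) ≈ fromℕ (occ a xs) * h a
    sum-δ []       a h = sym (zeroˡ _)
    sum-δ (y ∷ ys) a h with y ≟ a
    ... | yes ≡.refl = trans (+-cong (*-identityˡ _) (sum-δ ys y h))
                             (trans (+-congʳ (sym (*-identityˡ _))) (sym (distribʳ _ _ _)))
    ... | no  _      = trans (+-cong (zeroˡ _) (sum-δ ys a h)) (+-identityˡ _)

    module Enumerated {xs : List A} (enum : Enumerates xs) where

      sum-δ-enum : ∀ a (h : A → Carrier) → sumList xs (λ y → δ y a * h y) ≈ h a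
      sum-δ-enum a h = trans (sum-δ xs a h) (trans (*-congʳ (fromℕ-1 (enum a))) (*-identityˡ _))
        where
        fromℕ-1 : ∀ {n} → n ≡ 1 → fromℕ n ≈ 1#
        fromℕ-1 ≡.refl = +-identityʳ 1#

      sum-reindex : ∀ (g g′ : A → A) → (∀ y → g (g′ y) ≡ y) → (∀ x → g′ (g x) ≡ x) →
                    (f : A → Carrier) → sumList xs (f ∘ g) ≈ sumList xs f
      sum-reindex g g′ gg′≡id g′g≡id f = begin
        sumList xs (λ x → f (g x))
          ≈⟨ sum-cong xs (λ x → sum-δ-enum (g x) f) ⟨
        sumList xs (λ x → sumList xs (λ y → δ y (g x) * f y))
          ≈⟨ sum-comm xs xs (λ x y → δ y (g x) * f y) ⟩
        sumList xs (λ y → sumList xs (λ x → δ y (g x) * f y))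
          ≈⟨ sum-cong xs (λ y → sum-cong xs (λ x → *-congʳ (reflexive (swap x y)))) ⟩
        sumList xs (λ y → sumList xs (λ x → δ x (g′ y) * f y))
          ≈⟨ sum-cong xs (λ y → sum-δ-enum (g′ y) (λ _ → f y)) ⟩
        sumList xs f ∎
        where
        swap : ∀ x y → δ y (g x) ≡ δ x (g′ y)
        swap x y = δ-cong-⇔ (λ y≡gx → ≡.trans (≡.sym (g′g≡id x)) (≡.cong g′ (≡.sym y≡gx)))
                            (λ x≡g′y → ≡.trans (≡.sym (gg′≡id y)) (≡.cong g (≡.sym x≡g′y)))

      sum-const-except : ∀ a {f : A → Carrier} {k} → (∀ x → x ≢ a → f x ≈ k) →
                         sumList xs f + k ≈ f a + fromℕ (List.length xs) * k
      sum-const-except a {f} {k} f≈k = begin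
        sumList xs f + k                                        ≈⟨ +-congˡ (sum-δ-enum a (λ _ → k)) ⟨
        sumList xs f + sumList xs (λ x → δ x a * k)             ≈⟨ sum-distrib-+ xs f _ ⟨
        sumList xs (λ x → f x + δ x a * k)                      ≈⟨ sum-cong xs swap-at-a ⟩
        sumList xs (λ x → δ x a * f a + k)                      ≈⟨ sum-distrib-+ xs _ (λ _ → k) ⟩
        sumList xs (λ x → δ x a * f a) + sumList xs (λ _ → k)
          ≈⟨ +-cong (sum-δ-enum a (λ _ → f a)) (sum-const xs k) ⟩
        f a + fromℕ (List.length xs) * k                        ∎
        where
        swap-at-a : ∀ x → f x + δ x a * k ≈ δ x a * f a + k
        swap-at-a x with x ≟ a
        ... | yes ≡.refl = trans (+-congˡ (*-identityˡ k)) (+-congʳ (sym (*-identityˡ (f x))))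
        ... | no  x≢a    = trans (+-cong (f≈k x x≢a) (zeroˡ k)) (trans (+-comm k 0#) (+-congʳ (sym (zeroˡ (f a)))))

module Arrangements {a} {A : Set a} (_≟_ : DecidableEquality A) {es : List A}
                    (es-enum : Occurrences.Enumerates _≟_ es) where
  open Occurrences _≟_
  open import Algebra.Properties.CommutativeSemigroup ℕ.+-commutativeSemigroup using (x∙yz≈y∙xz)

  hasCounts : ∀ {n} → (A → ℕ) → Vec A n → Bool
  hasCounts m τ = all (λ a → Vec.count (a ≟_) τ ≡ᵇ m a) es

  _without_ : (A → ℕ) → A → A → ℕ
  (m without a) b = if does (b ≟ a) then 0 else m b

  sumℕ-without : ∀ {m a} → m a ≡ 1 → ∀ xs →
                 sumℕ (List.map m xs) ≡ occ a xs ℕ.+ sumℕ (List.map (m without a) xs)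
  sumℕ-without ma≡1 []       = ≡.refl
  sumℕ-without {m} {a} ma≡1 (y ∷ xs) with y ≟ a
  ... | yes ≡.refl rewrite ma≡1 = ≡.cong suc (sumℕ-without ma≡1 xs)
  ... | no  _      = ≡.trans (≡.cong (m y ℕ.+_) (sumℕ-without ma≡1 xs)) (x∙yz≈y∙xz (m y) (occ a xs) _)

  sumℕ-without-enum : ∀ {m a} → m a ≡ 1 → sumℕ (List.map m es) ≡ suc (sumℕ (List.map (m without a) es))
  sumℕ-without-enum {m} {a} ma≡1 =
    ≡.trans (sumℕ-without ma≡1 es) (≡.cong (ℕ._+ sumℕ (List.map (m without a) es)) (es-enum a))

  hasCounts-∷-absent : ∀ {n m a} (τ : Vec A n) → m a ≡ 0 → hasCounts m (a ∷ τ) ≡ false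
  hasCounts-∷-absent {m = m} {a} τ ma≡0 =
    all-∈-false (λ b → Vec.count (b ≟_) (a ∷ τ) ≡ᵇ m b) (enumerates⇒∈ {es} es-enum a) count≢0
    where
    count≢0 : (Vec.count (a ≟_) (a ∷ τ) ≡ᵇ m a) ≡ false
    count≢0 rewrite ma≡0 with a ≟ a
    ... | yes _   = ≡.refl
    ... | no  a≢a = ⊥-elim (a≢a ≡.refl)

  hasCounts-∷-present : ∀ {n m a} (τ : Vec A n) → m a ≡ 1 → hasCounts m (a ∷ τ) ≡ hasCounts (m without a) τ
  hasCounts-∷-present {m = m} {a} τ ma≡1 = ≡.cong and (List.map-cong count-∷ es)
    where
    count-∷ : ∀ b → (Vec.count (b ≟_) (a ∷ τ) ≡ᵇ m b) ≡ (Vec.count (b ≟_) τ ≡ᵇ (m without a) b)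
    count-∷ b with b ≟ a
    ... | yes ≡.refl rewrite ma≡1 = ≡.refl
    ... | no  _      = ≡.refl

  hasCounts-[] : ∀ m → sumℕ (List.map m es) ≡ 0 → hasCounts m [] ≡ true
  hasCounts-[] m = go es
    where
    go : ∀ xs → sumℕ (List.map m xs) ≡ 0 → all (λ a → 0 ≡ᵇ m a) xs ≡ true
    go []       _     = ≡.refl
    go (x ∷ xs) Σm≡0 rewrite ℕ.m+n≡0⇒m≡0 (m x) Σm≡0 = go xs (ℕ.m+n≡0⇒n≡0 (m x) Σm≡0)

  module _ {c ℓ} (R : RealClosedField c ℓ) where
    open RealClosedField R hiding (_≤_)
    open OrderedField R using (fromℕ-*)
    open FiniteSums R
    open import Relation.Binary.Reasoning.Setoid setoid

    -- m is the indicator of an n-element subset of A, and hasCounts m picks out its arrangements.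
    count-arrangements : ∀ n (m : A → ℕ) → (∀ a → m a ℕ.≤ 1) → sumℕ (List.map m es) ≡ n →
                         sumList (allVecs n es) (ι ∘ hasCounts m) ≈ fromℕ (n !)
    count-arrangements zero    m m≤1 Σm≡0 rewrite hasCounts-[] m Σm≡0 = refl
    count-arrangements (suc n) m m≤1 Σm≡1+n = begin
      sumList (allVecs (suc n) es) (ι ∘ hasCounts m)
        ≈⟨ sum-concatMap _ es _ ⟩
      sumList es (λ a → sumList (List.map (a ∷_) (allVecs n es)) (ι ∘ hasCounts m))
        ≈⟨ sum-cong es (λ a → sum-map (a ∷_) (allVecs n es) _) ⟩
      sumList es (λ a → sumList (allVecs n es) (λ τ → ι (hasCounts m (a ∷ τ))))
        ≈⟨ sum-cong es first-entry ⟩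
      sumList es (λ a → fromℕ (m a) * fromℕ (n !))
        ≈⟨ *-distribʳ-sum es _ (fromℕ ∘ m) ⟨
      sumList es (fromℕ ∘ m) * fromℕ (n !)
        ≈⟨ *-congʳ (trans (sum-fromℕ es m) (reflexive (≡.cong fromℕ Σm≡1+n))) ⟩
      fromℕ (suc n) * fromℕ (n !)
        ≈⟨ fromℕ-* (suc n) (n !) ⟨
      fromℕ (suc n !) ∎
      where
      first-entry : ∀ a → sumList (allVecs n es) (λ τ → ι (hasCounts m (a ∷ τ))) ≈ fromℕ (m a) * fromℕ (n !)
      first-entry a with m a in ma≡ | m≤1 a
      ... | 0 | _ = begin
        sumList (allVecs n es) (λ τ → ι (hasCounts m (a ∷ τ)))
          ≈⟨ sum-cong (allVecs n es) (λ τ → reflexive (≡.cong ι (hasCounts-∷-absent τ ma≡))) ⟩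
        sumList (allVecs n es) (λ _ → 0#)                      ≈⟨ sum-zero (allVecs n es) ⟩
        0#                                                     ≈⟨ zeroˡ _ ⟨
        0# * fromℕ (n !)                                       ∎
      ... | 1 | _ = begin
        sumList (allVecs n es) (λ τ → ι (hasCounts m (a ∷ τ)))
          ≈⟨ sum-cong (allVecs n es) (λ τ → reflexive (≡.cong ι (hasCounts-∷-present τ ma≡))) ⟩
        sumList (allVecs n es) (ι ∘ hasCounts (m without a))
          ≈⟨ count-arrangements n (m without a) without≤1 Σwithout≡n ⟩
        fromℕ (n !)                                                  ≈⟨ *-identityˡ _ ⟨
        1# * fromℕ (n !)                                             ≈⟨ *-congʳ (+-identityʳ 1#) ⟨
        fromℕ 1 * fromℕ (n !)                                        ∎
        where
        without≤1 : ∀ b → (m without a) b ℕ.≤ 1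
        without≤1 b with b ≟ a
        ... | yes _ = ℕ.z≤n
        ... | no  _ = m≤1 b
        Σwithout≡n : sumℕ (List.map (m without a) es) ≡ n
        Σwithout≡n = ℕ.suc-injective (≡.trans (≡.sym (sumℕ-without-enum ma≡)) Σm≡1+n)
      ... | suc (suc _) | ℕ.s≤s ()

fieldRing : ∀ {f} → FiniteField f → CommutativeRing f f
fieldRing F = record { isCommutativeRing = FiniteField.isCommutativeRing F }

module FiniteFieldProperties {f} (F : FiniteField f) where
  open FiniteField F renaming (Carrier to 𝔽)
  open Occurrences _≟_

  elements-enumerates : Enumerates elements
  elements-enumerates a with enum-surjective a
  ... | i , ≡.refl = ≡.trans (occ-map-injective Fin._≟_ _≟_ (enum-injective _ _) i (List.allFin size))
                             (allFin-enumerates size i)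

  length-elements : List.length elements ≡ size
  length-elements = ≡.trans (List.length-map enum (List.allFin size)) (List.length-tabulate id)

  index : 𝔽 → Fin size
  index = proj₁ ∘ enum-surjective

  index-injective : ∀ {a b} → index a ≡ index b → a ≡ b
  index-injective {a} {b} eq = ≡.trans (≡.sym (proj₂ (enum-surjective a)))
                                       (≡.trans (≡.cong enum eq) (proj₂ (enum-surjective b)))

  index-0≢index-1 : index 0# ≢ index 1#
  index-0≢index-1 = 0≢1 ∘ index-injective

  size≡2+ : ∃ λ r → size ≡ suc (suc r)
  size≡2+ with size | index 0# | index 1# | index-0≢index-1
  ... | suc zero    | zero | zero | i₀≢i₁ = ⊥-elim (i₀≢i₁ ≡.refl)
  ... | suc (suc r) | _    | _    | _     = r , ≡.refl

  private
    module ℱ = CommutativeRing (fieldRing F)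

  *-inverse-cancel : ∀ {c c′} → c′ * c ≡ 1# → ∀ x → c′ * (c * x) ≡ x
  *-inverse-cancel c′c≡1 x = ≡.trans (≡.sym (ℱ.*-assoc _ _ x)) (≡.trans (≡.cong (_* x) c′c≡1) (ℱ.*-identityˡ x))

  *-cancelˡ-≢0 : ∀ {c a b} → c ≢ 0# → c * a ≡ c * b → a ≡ b
  *-cancelˡ-≢0 {c} {a} {b} c≢0 ca≡cb with inverse c c≢0
  ... | c′ , cc′≡1 = ≡.trans (≡.sym (cancel a)) (≡.trans (≡.cong (c′ *_) ca≡cb) (cancel b))
    where cancel = *-inverse-cancel (≡.trans (ℱ.*-comm c′ c) cc′≡1)

module FieldVectors {f} (F : FiniteField f) where
  open FiniteField F using () renaming (Carrier to 𝔽)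
  open FiniteFieldProperties F using (*-inverse-cancel)
  open CommutativeRing (fieldRing F) hiding (Carrier; refl; sym; trans)
  open import Algebra.Properties.AbelianGroup +-abelianGroup using (xyx⁻¹≈y; ⁻¹-∙-comm)
  open import Algebra.Properties.Group +-group using (//-rightDividesˡ; //-rightDividesʳ)
  open import Algebra.Properties.Ring ring using ([y-z]x≈yx-zx; x[y-z]≈xy-xz)
  open import Algebra.Properties.CommutativeSemigroup +-commutativeSemigroup using (interchange)
  open ≡.≡-Reasoning

  infixl 6 _⊕_ _⊖_
  infixr 7 _⊙_

  _⊕_ : ∀ {n} → Vec 𝔽 n → Vec 𝔽 n → Vec 𝔽 n
  _⊕_ = Vec.zipWith _+_

  -- the expression of Omega._-ᵥ_, so that Omega.A x y unfolds to a function of y ⊖ x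
  _⊖_ : ∀ {n} → Vec 𝔽 n → Vec 𝔽 n → Vec 𝔽 n
  _⊖_ = Vec.zipWith (λ b a → b + - a)

  _⊙_ : ∀ {n} → 𝔽 → Vec 𝔽 n → Vec 𝔽 n
  c ⊙ x = Vec.map (c *_) x

  ⊕-comm : ∀ {n} (x y : Vec 𝔽 n) → x ⊕ y ≡ y ⊕ x
  ⊕-comm = Vec.zipWith-comm +-comm

  ⊕-⊖-cancel : ∀ {n} (x t : Vec 𝔽 n) → (x ⊕ t) ⊖ t ≡ x
  ⊕-⊖-cancel []      []      = ≡.refl
  ⊕-⊖-cancel (a ∷ x) (b ∷ t) = ≡.cong₂ _∷_ (//-rightDividesʳ b a) (⊕-⊖-cancel x t)

  ⊖-⊕-cancel : ∀ {n} (x t : Vec 𝔽 n) → (x ⊖ t) ⊕ t ≡ x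
  ⊖-⊕-cancel []      []      = ≡.refl
  ⊖-⊕-cancel (a ∷ x) (b ∷ t) = ≡.cong₂ _∷_ (//-rightDividesˡ b a) (⊖-⊕-cancel x t)

  ⊕-⊖-cancelˡ : ∀ {n} (x σ : Vec 𝔽 n) → (x ⊕ σ) ⊖ x ≡ σ
  ⊕-⊖-cancelˡ []      []      = ≡.refl
  ⊕-⊖-cancelˡ (a ∷ x) (b ∷ σ) = ≡.cong₂ _∷_ (xyx⁻¹≈y a b) (⊕-⊖-cancelˡ x σ)

  ⊙-inverse : ∀ {n c c′} → c′ * c ≡ 1# → (x : Vec 𝔽 n) → c′ ⊙ c ⊙ x ≡ x
  ⊙-inverse c′c≡1 []      = ≡.refl
  ⊙-inverse c′c≡1 (a ∷ x) = ≡.cong₂ _∷_ (*-inverse-cancel c′c≡1 a) (⊙-inverse c′c≡1 x)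

  ⊕-0⊙ : ∀ {n} (x σ : Vec 𝔽 n) → x ⊕ 0# ⊙ σ ≡ x
  ⊕-0⊙ []      []      = ≡.refl
  ⊕-0⊙ (a ∷ x) (b ∷ σ) = ≡.cong₂ _∷_ (≡.trans (≡.cong (a +_) (zeroˡ b)) (+-identityʳ a)) (⊕-0⊙ x σ)

  ⊕-⊙-shift : ∀ {n} c d (x σ : Vec 𝔽 n) → (x ⊕ c ⊙ σ) ⊕ (d + - c) ⊙ σ ≡ x ⊕ d ⊙ σ
  ⊕-⊙-shift c d []      []      = ≡.refl
  ⊕-⊙-shift c d (a ∷ x) (b ∷ σ) = ≡.cong₂ _∷_ shift (⊕-⊙-shift c d x σ)
    where
    shift : (a + c * b) + (d + - c) * b ≡ a + d * b
    shift = begin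
      (a + c * b) + (d + - c) * b          ≡⟨ ≡.cong ((a + c * b) +_) ([y-z]x≈yx-zx b d c) ⟩
      (a + c * b) + (d * b + - (c * b))    ≡⟨ interchange a (c * b) (d * b) (- (c * b)) ⟩
      (a + d * b) + (c * b + - (c * b))    ≡⟨ ≡.cong ((a + d * b) +_) (-‿inverseʳ (c * b)) ⟩
      (a + d * b) + 0#                     ≡⟨ +-identityʳ _ ⟩
      a + d * b                            ∎

  coordinateDifference : ∀ {n} → Fin n → Fin n → Vec 𝔽 n → 𝔽
  coordinateDifference i j σ = Vec.lookup σ i + - Vec.lookup σ j

  coordinateDifference-⊕ : ∀ {n} (i j : Fin n) x y →
    coordinateDifference i j (x ⊕ y) ≡ coordinateDifference i j x + coordinateDifference i j y
  coordinateDifference-⊕ i j x y = begin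
    lookup (x ⊕ y) i + - lookup (x ⊕ y) j
      ≡⟨ ≡.cong₂ (λ a b → a + - b) (Vec.lookup-zipWith _+_ i x y) (Vec.lookup-zipWith _+_ j x y) ⟩
    (lookup x i + lookup y i) + - (lookup x j + lookup y j)
      ≡⟨ ≡.cong ((lookup x i + lookup y i) +_) (⁻¹-∙-comm (lookup x j) (lookup y j)) ⟨
    (lookup x i + lookup y i) + (- lookup x j + - lookup y j)
      ≡⟨ interchange _ _ _ _ ⟩
    coordinateDifference i j x + coordinateDifference i j y ∎
    where lookup = Vec.lookup

  coordinateDifference-⊙ : ∀ {n} (i j : Fin n) c x → coordinateDifference i j (c ⊙ x) ≡ c * coordinateDifference i j x
  coordinateDifference-⊙ i j c x =
    ≡.trans (≡.cong₂ (λ a b → a + - b) (Vec.lookup-map i (c *_) x) (Vec.lookup-map j (c *_) x))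
            (≡.sym (x[y-z]≈xy-xz c _ _))

module PermutationVectors {f} (F : FiniteField f) where
  open FiniteField F renaming (Carrier to 𝔽)
  open CommutativeRing (fieldRing F) using (*-comm)
  open FieldVectors F
  open FiniteFieldProperties F
  open Arrangements _≟_ {elements} elements-enumerates

  IsPermutation : ∀ {n} → Vec 𝔽 n → Set f
  IsPermutation σ = ∀ a → Vec.count (a ≟_) σ ≡ 1

  isPermutation : ∀ {n} → Vec 𝔽 n → Bool
  isPermutation = hasCounts (λ _ → 1)

  T-isPermutation : ∀ {n} (σ : Vec 𝔽 n) → T (isPermutation σ) ⇔ IsPermutation σ
  T-isPermutation σ = mk⇔
    (λ t a → ℕ.≡ᵇ⇒≡ _ 1 (All.lookup (All.all⁺ _ elements t) (∈-elements a)))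
    (λ perm → All.all⁻ (λ a → Vec.count (a ≟_) σ ≡ᵇ 1) {elements} (All.tabulate (λ {a} _ → ℕ.≡⇒≡ᵇ _ 1 (perm a))))
    where ∈-elements = Occurrences.enumerates⇒∈ _≟_ {elements} elements-enumerates

  IsPermutation-⊙ : ∀ {n c c′} → c′ * c ≡ 1# → (σ : Vec 𝔽 n) →
                    IsPermutation σ → IsPermutation (c ⊙ σ)
  IsPermutation-⊙ {c = c} {c′} c′c≡1 σ perm a =
    ≡.trans (count-map-⇔ (a ≟_) ((c′ * a) ≟_) (c *_) (λ x → mk⇔ (to x) (from x)) σ) (perm (c′ * a))
    where
    to : ∀ x → a ≡ c * x → c′ * a ≡ x
    to x a≡cx = ≡.trans (≡.cong (c′ *_) a≡cx) (*-inverse-cancel c′c≡1 x)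
    from : ∀ x → c′ * a ≡ x → a ≡ c * x
    from x c′a≡x = ≡.trans (≡.sym (*-inverse-cancel (≡.trans (*-comm c c′) c′c≡1) a)) (≡.cong (c *_) c′a≡x)

  T-isPermutation-⊙ : ∀ {n c c′} → c′ * c ≡ 1# → (σ : Vec 𝔽 n) →
                      T (isPermutation σ) → T (isPermutation (c ⊙ σ))
  T-isPermutation-⊙ {c = c} c′c≡1 σ =
    Equivalence.from (T-isPermutation (c ⊙ σ)) ∘ IsPermutation-⊙ c′c≡1 σ ∘ Equivalence.to (T-isPermutation σ)

  isPermutation-⊙ : ∀ {n c} → c ≢ 0# → (σ : Vec 𝔽 n) → isPermutation (c ⊙ σ) ≡ isPermutation σ
  isPermutation-⊙ {c = c} c≢0 σ with inverse c c≢0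
  ... | c′ , cc′≡1 = T-⇔⇒≡ (mk⇔
    (≡.subst (T ∘ isPermutation) (⊙-inverse (≡.trans (*-comm c′ c) cc′≡1) σ) ∘ T-isPermutation-⊙ cc′≡1 (c ⊙ σ))
    (T-isPermutation-⊙ (≡.trans (*-comm c′ c) cc′≡1) σ))

  isPermutation-injective : ∀ {n} {σ : Vec 𝔽 n} → T (isPermutation σ) →
                            ∀ {i j} → i ≢ j → Vec.lookup σ i ≢ Vec.lookup σ j
  isPermutation-injective {σ = σ} t {i} i≢j σᵢ≡σⱼ = ℕ.<-irrefl ≡.refl
    (≡.subst (2 ℕ.≤_) (Equivalence.to (T-isPermutation σ) t (Vec.lookup σ i))
             (count≥2 (Vec.lookup σ i ≟_) σ i≢j ≡.refl σᵢ≡σⱼ))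

  module _ {c ℓ} (R : RealClosedField c ℓ) where
    open RealClosedField R using (_≈_; sumList; fromℕ)
    open FiniteSums R using (ι)

    count-permutations : sumList (allVecs size elements) (ι ∘ isPermutation) ≈ fromℕ (size !)
    count-permutations = count-arrangements R size (λ _ → 1) (λ _ → ℕ.≤-refl) Σ1≡size
      where
      Σ1≡size : sumℕ (List.map (λ _ → 1) elements) ≡ size
      Σ1≡size = ≡.trans (sumℕ-map-1 elements) length-elements

module FieldCardinality {f c ℓ} (F : FiniteField f) (R : RealClosedField c ℓ) where
  open FiniteField F using (size; elements; _≟_) renaming (Carrier to 𝔽)
  open RealClosedField R hiding (_≤_)
  open OrderedField R using (fromℕ-suc≉0)
  open FiniteSums R using (sum-const)
  open FiniteFieldProperties F using (elements-enumerates; length-elements; size≡2+)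
  open FiniteSums.Indicator.Enumerated R _≟_ {elements} elements-enumerates using (sum-const-except)
  open import Algebra.Properties.Group +-group using (∙-cancelʳ)
  open import Relation.Binary.Reasoning.Setoid setoid

  q : Carrier
  q = fromℕ size

  q-1 : Carrier
  q-1 = fromℕ (size ∸ 1)

  q≈q-1+1 : q ≈ q-1 + 1#
  q≈q-1+1 = ≡.subst (λ m → fromℕ m ≈ fromℕ (m ∸ 1) + 1#) (≡.sym (proj₂ size≡2+)) (+-comm 1# _)

  q*k≈q-1*k+k : ∀ k → q * k ≈ q-1 * k + k
  q*k≈q-1*k+k k = trans (*-congʳ q≈q-1+1) (trans (distribʳ k q-1 1#) (+-congˡ (*-identityˡ k)))

  q-1≉0 : q-1 ≉ 0#
  q-1≉0 = ≡.subst (λ m → fromℕ (m ∸ 1) ≉ 0#) (≡.sym (proj₂ size≡2+)) (fromℕ-suc≉0 (proj₁ size≡2+))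

  q≉0 : q ≉ 0#
  q≉0 = ≡.subst (λ m → fromℕ m ≉ 0#) (≡.sym (proj₂ size≡2+)) (fromℕ-suc≉0 (suc (proj₁ size≡2+)))

  sum-elements-const : ∀ k → sumList elements (λ _ → k) ≈ q * k
  sum-elements-const k = trans (sum-const elements k) (*-congʳ (reflexive (≡.cong fromℕ length-elements)))

  sum-elements-except : ∀ a {f : 𝔽 → Carrier} {k} → (∀ x → x ≢ a → f x ≈ k) →
                        sumList elements f ≈ f a + q-1 * k
  sum-elements-except a {f} {k} f≈k = ∙-cancelʳ k _ _ (begin
    sumList elements f + k                  ≈⟨ sum-const-except a f≈k ⟩
    f a + fromℕ (List.length elements) * k  ≡⟨ ≡.cong (λ m → f a + fromℕ m * k) length-elements ⟩
    f a + q * k                             ≈⟨ +-congˡ (q*k≈q-1*k+k k) ⟩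
    f a + (q-1 * k + k)                     ≈⟨ +-assoc _ _ _ ⟨
    f a + q-1 * k + k                       ∎)

module CayleyGraph {f c ℓ} (F : FiniteField f) (R : RealClosedField c ℓ) {n : ℕ}
                   (β : Vec (FiniteField.Carrier F) n → RealClosedField.Carrier R) where
  open FiniteField F using (size; elements; _≟_; inverse)
    renaming (Carrier to 𝔽; 0# to 0F; 1# to 1F; _+_ to _+F_; _*_ to _*F_; -_ to -F_)
  open RealClosedField R hiding (_≤_; inverse)
  open OrderedField R
  open FiniteSums R
  open Indicator _≟_ using (δ; δ-refl; δ-≢; δ-sym; δ-cong-⇔)
  open FieldVectors F
  open FiniteFieldProperties F
  open Indicator.Enumerated _≟_ {elements} elements-enumerates using (sum-δ-enum)
  open FieldCardinality F R
  open import Relation.Binary.Reasoning.Setoid setoid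
  open import Algebra.Properties.Group +-group using (//-rightDividesʳ)
  open import Algebra.Properties.AbelianGroup +-abelianGroup using (xyx⁻¹≈y)
  open import Algebra.Properties.Ring ring using (-‿distribˡ-*; -‿distribʳ-*)
  open import Algebra.Properties.CommutativeSemigroup *-commutativeSemigroup using (x∙yz≈y∙xz)
  open import Algebra.Solver.Ring.NaturalCoefficients.Default commutativeSemiring
    using (solve; _:+_; _:*_; _:=_)
  private
    module ℱ where
      open CommutativeRing (fieldRing F) public
      open import Algebra.Properties.Group (CommutativeRing.+-group (fieldRing F)) public

  Point : Set f
  Point = Vec 𝔽 n

  points : List Point
  points = allVecs n elements

  points-enumerates : Occurrences.Enumerates (Vec.≡-dec _≟_) points
  points-enumerates = allVecs-enumerates _≟_ elements-enumerates n

  private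
    module P = Indicator.Enumerated (Vec.≡-dec {n = n} _≟_) {points} points-enumerates

  degree : Carrier
  degree = sumList points β

  cayley : (Point → Carrier) → Point → Carrier
  cayley w x = sumList points (λ σ → β σ * w (x ⊕ σ))

  sum-translate : ∀ t (h : Point → Carrier) → sumList points (λ x → h (x ⊕ t)) ≈ sumList points h
  sum-translate t = P.sum-reindex (_⊕ t) (_⊖ t) (λ y → ⊖-⊕-cancel y t) (λ x → ⊕-⊖-cancel x t)

  cayley-matrix : ∀ (w : Point → Carrier) x → sumList points (λ y → β (y ⊖ x) * w y) ≈ cayley w x
  cayley-matrix w x = begin
    sumList points (λ y → β (y ⊖ x) * w y)
      ≈⟨ sum-translate x (λ y → β (y ⊖ x) * w y) ⟨
    sumList points (λ σ → β ((σ ⊕ x) ⊖ x) * w (σ ⊕ x))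
      ≈⟨ sum-cong points (λ σ → reflexive (≡.cong (λ y → β (y ⊖ x) * w y) (⊕-comm σ x))) ⟩
    sumList points (λ σ → β ((x ⊕ σ) ⊖ x) * w (x ⊕ σ))
      ≈⟨ sum-cong points (λ σ → reflexive (≡.cong (λ τ → β τ * w (x ⊕ σ)) (⊕-⊖-cancelˡ x σ))) ⟩
    cayley w x ∎

  module ScalingInvariant (β-⊙ : ∀ {c} → c ≢ 0F → ∀ σ → β (c ⊙ σ) ≈ β σ) where

    sum-dilate : ∀ {c} → c ≢ 0F → (h : Point → Carrier) →
                 sumList points (λ σ → β σ * h (c ⊙ σ)) ≈ sumList points (λ σ → β σ * h σ)
    sum-dilate {c} c≢0 h with inverse c c≢0
    ... | c′ , cc′≡1 = begin
      sumList points (λ σ → β σ * h (c ⊙ σ))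
        ≈⟨ sum-cong points (λ σ → *-congʳ (β-⊙ c≢0 σ)) ⟨
      sumList points (λ σ → β (c ⊙ σ) * h (c ⊙ σ))
        ≈⟨ P.sum-reindex (c ⊙_) (c′ ⊙_) (⊙-inverse cc′≡1) (⊙-inverse c′c≡1) (λ τ → β τ * h τ) ⟩
      sumList points (λ σ → β σ * h σ) ∎
      where
      c′c≡1 : c′ *F c ≡ 1F
      c′c≡1 = ≡.trans (CommutativeRing.*-comm (fieldRing F) c′ c) cc′≡1

    module _ {μ} {v : Point → Carrier} (eigen : ∀ x → cayley v x ≈ μ * v x) where

      norm² : Carrier
      norm² = sumList points (λ y → v y * v y)

      lineSum : Point → Point → Carrier
      lineSum x σ = sumList elements (λ c → v (x ⊕ c ⊙ σ))

      energy : Carrier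
      energy = sumList points (λ x → sumList points (λ σ → β σ * (lineSum x σ * lineSum x σ)))

      correlation : 𝔽 → 𝔽 → Carrier
      correlation c d = sumList points (λ x → sumList points (λ σ → β σ * (v (x ⊕ c ⊙ σ) * v (x ⊕ d ⊙ σ))))

      energy-expand : energy ≈ sumList elements (λ c → sumList elements (correlation c))
      energy-expand = trans (sum-cong points (λ x → sum-cong points (λ σ → square-expand x σ)))
                            (sum-comm-pairs points points elements elements _)
        where
        square-expand : ∀ x σ → β σ * (lineSum x σ * lineSum x σ) ≈
                        sumList elements (λ c → sumList elements (λ d → β σ * (v (x ⊕ c ⊙ σ) * v (x ⊕ d ⊙ σ))))
        square-expand x σ = begin
          β σ * (lineSum x σ * lineSum x σ)
            ≈⟨ *-congˡ (sum-*-sum elements elements _ _) ⟩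
          β σ * sumList elements (λ c → sumList elements (λ d → v (x ⊕ c ⊙ σ) * v (x ⊕ d ⊙ σ)))
            ≈⟨ *-distribˡ-sum elements (β σ) _ ⟩
          sumList elements (λ c → β σ * sumList elements (λ d → v (x ⊕ c ⊙ σ) * v (x ⊕ d ⊙ σ)))
            ≈⟨ sum-cong elements (λ c → *-distribˡ-sum elements (β σ) _) ⟩
          sumList elements (λ c → sumList elements (λ d → β σ * (v (x ⊕ c ⊙ σ) * v (x ⊕ d ⊙ σ)))) ∎

      -- substitute y = x ⊕ c ⊙ σ
      correlation-translate : ∀ c d → correlation c d ≈
        sumList points (λ σ → β σ * sumList points (λ y → v y * v (y ⊕ (d +F -F c) ⊙ σ)))
      correlation-translate c d = begin
        correlation c d
          ≈⟨ sum-comm points points _ ⟩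
        sumList points (λ σ → sumList points (λ x → β σ * (v (x ⊕ c ⊙ σ) * v (x ⊕ d ⊙ σ))))
          ≈⟨ sum-cong points (λ σ → *-distribˡ-sum points (β σ) _) ⟨
        sumList points (λ σ → β σ * sumList points (λ x → v (x ⊕ c ⊙ σ) * v (x ⊕ d ⊙ σ)))
          ≈⟨ sum-cong points (λ σ → *-congˡ (sum-cong points (λ x → *-congˡ (shift x σ)))) ⟩
        sumList points (λ σ → β σ * sumList points (λ x → v (x ⊕ c ⊙ σ) * v ((x ⊕ c ⊙ σ) ⊕ (d +F -F c) ⊙ σ)))
          ≈⟨ sum-cong points (λ σ → *-congˡ (sum-translate (c ⊙ σ) (λ y → v y * v (y ⊕ (d +F -F c) ⊙ σ)))) ⟩
        sumList points (λ σ → β σ * sumList points (λ y → v y * v (y ⊕ (d +F -F c) ⊙ σ))) ∎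
        where
        shift : ∀ x σ → v (x ⊕ d ⊙ σ) ≈ v ((x ⊕ c ⊙ σ) ⊕ (d +F -F c) ⊙ σ)
        shift x σ = reflexive (≡.cong v (≡.sym (⊕-⊙-shift c d x σ)))

      correlation-diagonal : ∀ c → correlation c c ≈ degree * norm²
      correlation-diagonal c = begin
        correlation c c
          ≈⟨ correlation-translate c c ⟩
        sumList points (λ σ → β σ * sumList points (λ y → v y * v (y ⊕ (c +F -F c) ⊙ σ)))
          ≈⟨ sum-cong points (λ σ → *-congˡ (sum-cong points (λ y → *-congˡ (reflexive (≡.cong v (y⊕0⊙σ y σ)))))) ⟩
        sumList points (λ σ → β σ * norm²)
          ≈⟨ *-distribʳ-sum points norm² β ⟨
        degree * norm² ∎
        where
        y⊕0⊙σ : ∀ y σ → y ⊕ (c +F -F c) ⊙ σ ≡ y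
        y⊕0⊙σ y σ = ≡.trans (≡.cong (λ e → y ⊕ e ⊙ σ) (ℱ.-‿inverseʳ c)) (⊕-0⊙ y σ)

      correlation-off-diagonal : ∀ {c d} → d ≢ c → correlation c d ≈ μ * norm²
      correlation-off-diagonal {c} {d} d≢c = begin
        correlation c d
          ≈⟨ correlation-translate c d ⟩
        sumList points (λ σ → β σ * sumList points (λ y → v y * v (y ⊕ e ⊙ σ)))
          ≈⟨ sum-cong points (λ σ → *-distribˡ-sum points (β σ) _) ⟩
        sumList points (λ σ → sumList points (λ y → β σ * (v y * v (y ⊕ e ⊙ σ))))
          ≈⟨ sum-comm points points _ ⟩
        sumList points (λ y → sumList points (λ σ → β σ * (v y * v (y ⊕ e ⊙ σ))))
          ≈⟨ sum-cong points (λ y → sum-cong points (λ σ → x∙yz≈y∙xz (β σ) (v y) _)) ⟩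
        sumList points (λ y → sumList points (λ σ → v y * (β σ * v (y ⊕ e ⊙ σ))))
          ≈⟨ sum-cong points (λ y → *-distribˡ-sum points (v y) _) ⟨
        sumList points (λ y → v y * sumList points (λ σ → β σ * v (y ⊕ e ⊙ σ)))
          ≈⟨ sum-cong points (λ y → *-congˡ (trans (sum-dilate e≢0 (λ τ → v (y ⊕ τ))) (eigen y))) ⟩
        sumList points (λ y → v y * (μ * v y))
          ≈⟨ sum-cong points (λ y → x∙yz≈y∙xz (v y) μ (v y)) ⟩
        sumList points (λ y → μ * (v y * v y))
          ≈⟨ *-distribˡ-sum points μ _ ⟨
        μ * norm² ∎
        where
        e = d +F -F c
        e≢0 : e ≢ 0F
        e≢0 e≡0 = d≢c (ℱ.x∙y⁻¹≈ε⇒x≈y d c e≡0)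

      sum-correlation : ∀ c → sumList elements (correlation c) ≈ degree * norm² + q-1 * (μ * norm²)
      sum-correlation c = trans (sum-elements-except c (λ d → correlation-off-diagonal))
                                (+-congʳ (correlation-diagonal c))

      energy≈ : energy ≈ (q * norm²) * (degree + q-1 * μ)
      energy≈ = begin
        energy
          ≈⟨ energy-expand ⟩
        sumList elements (λ c → sumList elements (correlation c))
          ≈⟨ sum-cong elements sum-correlation ⟩
        sumList elements (λ _ → degree * norm² + q-1 * (μ * norm²))
          ≈⟨ sum-elements-const _ ⟩
        q * (degree * norm² + q-1 * (μ * norm²))
          ≈⟨ solve 5 (λ n w s k m → n :* (s :* w :+ k :* (m :* w)) := (n :* w) :* (s :+ k :* m))
                     refl q norm² degree q-1 μ ⟩
        (q * norm²) * (degree + q-1 * μ) ∎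

    eigenvalue-lower-bound : (∀ σ → 0# ≤ β σ) → ∀ {μ v x₀} → v x₀ ≉ 0# → (∀ x → cayley v x ≈ μ * v x) →
                             0# ≤ degree + q-1 * μ
    eigenvalue-lower-bound β-nonneg {v = v} {x₀} vx₀≉0 eigen =
      nonneg-*-cancelˡ (*-nonneg (fromℕ-nonneg size) norm²-nonneg) (*-≉0 q≉0 norm²≉0)
        (≤-resp-≈ refl (energy≈ eigen) energy-nonneg)
      where
      norm²-nonneg : 0# ≤ norm² eigen
      norm²-nonneg = sum-nonneg points (λ y → square-nonneg (v y))
      norm²≉0 : norm² eigen ≉ 0#
      norm²≉0 = nonneg-sum-≉0 (Occurrences.enumerates⇒∈ _ {points} points-enumerates x₀)
                              (λ y → square-nonneg (v y)) (square-≉0 vx₀≉0)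
      energy-nonneg : 0# ≤ energy eigen
      energy-nonneg = sum-nonneg points (λ x → sum-nonneg points (λ σ →
                        *-nonneg (β-nonneg σ) (square-nonneg (lineSum eigen x σ))))

    module LinearFunctional (φ : Point → 𝔽) (φ-⊕ : ∀ x y → φ (x ⊕ y) ≡ φ x +F φ y)
                            (φ-⊙ : ∀ c x → φ (c ⊙ x) ≡ c *F φ x)
                            (β-ker : ∀ σ → φ σ ≡ 0F → β σ ≈ 0#) where

      χ : Point → Carrier
      χ y = q * δ (φ y) 0F + - 1#

      χ-ker : ∀ {y} → φ y ≡ 0F → χ y ≈ q-1
      χ-ker {y} φy≡0 = begin
        q * δ (φ y) 0F + - 1#   ≈⟨ +-congʳ (*-congˡ (reflexive (≡.cong (λ a → δ a 0F) φy≡0))) ⟩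
        q * δ 0F 0F + - 1#      ≈⟨ +-congʳ (trans (*-congˡ (reflexive (δ-refl 0F))) (*-identityʳ q)) ⟩
        q + - 1#                ≈⟨ +-congʳ q≈q-1+1 ⟩
        q-1 + 1# + - 1#         ≈⟨ //-rightDividesʳ 1# q-1 ⟩
        q-1                     ∎

      χ-off-ker : ∀ {y} → φ y ≢ 0F → χ y ≈ - 1#
      χ-off-ker {y} φy≢0 = trans (+-congʳ (trans (*-congˡ (reflexive (δ-≢ φy≢0))) (zeroʳ q))) (+-identityˡ (- 1#))

      hits : 𝔽 → Carrier
      hits d = sumList points (λ σ → β σ * δ (φ σ) d)

      hits-0 : hits 0F ≈ 0#
      hits-0 = trans (sum-cong points β·δ≈0) (sum-zero points)
        where
        β·δ≈0 : ∀ σ → β σ * δ (φ σ) 0F ≈ 0#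
        β·δ≈0 σ with φ σ ≟ 0F
        ... | yes φσ≡0 = trans (*-congʳ (β-ker σ φσ≡0)) (zeroˡ _)
        ... | no  _    = zeroʳ _

      hits-dilate : ∀ {d} → d ≢ 0F → hits d ≈ hits 1F
      hits-dilate {d} d≢0 = begin
        hits d                                        ≈⟨ sum-dilate d≢0 (λ τ → δ (φ τ) d) ⟨
        sumList points (λ σ → β σ * δ (φ (d ⊙ σ)) d)  ≈⟨ sum-cong points (λ σ → *-congˡ (reflexive (φdσ≡d⇔φσ≡1 σ))) ⟩
        hits 1F                                       ∎
        where
        φdσ≡d⇔φσ≡1 : ∀ σ → δ (φ (d ⊙ σ)) d ≡ δ (φ σ) 1F
        φdσ≡d⇔φσ≡1 σ = δ-cong-⇔
          (λ φdσ≡d → *-cancelˡ-≢0 d≢0 (≡.trans (≡.sym (φ-⊙ d σ)) (≡.trans φdσ≡d (≡.sym (ℱ.*-identityʳ d)))))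
          (λ φσ≡1 → ≡.trans (φ-⊙ d σ) (≡.trans (≡.cong (d *F_) φσ≡1) (ℱ.*-identityʳ d)))

      sum-hits : sumList elements hits ≈ degree
      sum-hits = begin
        sumList elements hits
          ≈⟨ sum-comm elements points _ ⟩
        sumList points (λ σ → sumList elements (λ d → β σ * δ (φ σ) d))
          ≈⟨ sum-cong points (λ σ → *-distribˡ-sum elements (β σ) _) ⟨
        sumList points (λ σ → β σ * sumList elements (δ (φ σ)))
          ≈⟨ sum-cong points (λ σ → trans (*-congˡ (sum-δ-1 (φ σ))) (*-identityʳ (β σ))) ⟩
        degree ∎
        where
        sum-δ-1 : ∀ a → sumList elements (δ a) ≈ 1#
        sum-δ-1 a = trans (sum-cong elements (λ d → trans (sym (*-identityʳ _)) (*-congʳ (reflexive (δ-sym a d)))))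
                          (sum-δ-enum a (λ _ → 1#))

      module _ {K} (q-1*K≈degree : q-1 * K ≈ degree) where

        hits≈K : ∀ {d} → d ≢ 0F → hits d ≈ K
        hits≈K d≢0 = trans (hits-dilate d≢0) (*-cancelˡ q-1≉0 (trans q-1*hits1≈degree (sym q-1*K≈degree)))
          where
          q-1*hits1≈degree : q-1 * hits 1F ≈ degree
          q-1*hits1≈degree = sym (begin
            degree                         ≈⟨ sum-hits ⟨
            sumList elements hits          ≈⟨ sum-elements-except 0F (λ d d≢0 → hits-dilate d≢0) ⟩
            hits 0F + q-1 * hits 1F        ≈⟨ trans (+-congʳ hits-0) (+-identityˡ _) ⟩
            q-1 * hits 1F                  ∎)

        cayley-χ : ∀ x → cayley χ x ≈ q * hits (-F φ x) + - degree
        cayley-χ x = begin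
          cayley χ x
            ≈⟨ sum-cong points (λ σ → distribˡ (β σ) _ _) ⟩
          sumList points (λ σ → β σ * (q * δ (φ (x ⊕ σ)) 0F) + β σ * - 1#)
            ≈⟨ sum-distrib-+ points _ _ ⟩
          sumList points (λ σ → β σ * (q * δ (φ (x ⊕ σ)) 0F)) + sumList points (λ σ → β σ * - 1#)
            ≈⟨ +-cong (sum-cong points (λ σ → trans (x∙yz≈y∙xz (β σ) q _) (*-congˡ (*-congˡ (kernel-shift σ)))))
                      (sum-cong points (λ σ → trans (sym (-‿distribʳ-* (β σ) 1#)) (-‿cong (*-identityʳ (β σ))))) ⟩
          sumList points (λ σ → q * (β σ * δ (φ σ) (-F φ x))) + sumList points (λ σ → - β σ)
            ≈⟨ +-cong (*-distribˡ-sum points q _) (-‿distrib-sum points β) ⟨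
          q * hits (-F φ x) + - degree ∎
          where
          kernel-shift : ∀ σ → δ (φ (x ⊕ σ)) 0F ≈ δ (φ σ) (-F φ x)
          kernel-shift σ = reflexive (≡.trans (≡.cong (λ a → δ a 0F) (φ-⊕ x σ))
            (δ-cong-⇔ (ℱ.inverseʳ-unique (φ x) (φ σ))
                      (λ φσ≡-φx → ≡.trans (≡.cong (φ x +F_) φσ≡-φx) (ℱ.-‿inverseʳ (φ x)))))

        χ-eigenvector-ker : ∀ {x} → φ x ≡ 0F → cayley χ x ≈ - K * χ x
        χ-eigenvector-ker {x} φx≡0 = begin
          cayley χ x                     ≈⟨ cayley-χ x ⟩
          q * hits (-F φ x) + - degree   ≈⟨ +-cong (*-congˡ (reflexive (≡.cong hits -φx≡0))) (-‿cong (sym q-1*K≈degree)) ⟩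
          q * hits 0F + - (q-1 * K)      ≈⟨ trans (+-congʳ (trans (*-congˡ hits-0) (zeroʳ q))) (+-identityˡ _) ⟩
          - (q-1 * K)                    ≈⟨ -‿cong (*-comm q-1 K) ⟩
          - (K * q-1)                    ≈⟨ -‿distribˡ-* K q-1 ⟩
          - K * q-1                      ≈⟨ *-congˡ (χ-ker φx≡0) ⟨
          - K * χ x                      ∎
          where
          -φx≡0 : -F φ x ≡ 0F
          -φx≡0 = ≡.trans (≡.cong -F_ φx≡0) ℱ.ε⁻¹≈ε

        χ-eigenvector-off-ker : ∀ {x} → φ x ≢ 0F → cayley χ x ≈ - K * χ x
        χ-eigenvector-off-ker {x} φx≢0 = begin
          cayley χ x                     ≈⟨ cayley-χ x ⟩
          q * hits (-F φ x) + - degree   ≈⟨ +-cong (*-congˡ (hits≈K -φx≢0)) (-‿cong (sym q-1*K≈degree)) ⟩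
          q * K + - (q-1 * K)            ≈⟨ +-congʳ (q*k≈q-1*k+k K) ⟩
          q-1 * K + K + - (q-1 * K)      ≈⟨ xyx⁻¹≈y (q-1 * K) K ⟩
          K                              ≈⟨ *-identityʳ K ⟨
          K * 1#                         ≈⟨ -x*-y≈x*y K 1# ⟨
          - K * - 1#                     ≈⟨ *-congˡ (χ-off-ker φx≢0) ⟨
          - K * χ x                      ∎
          where
          -φx≢0 : -F φ x ≢ 0F
          -φx≢0 -φx≡0 = φx≢0 (ℱ.⁻¹-injective (≡.trans -φx≡0 (≡.sym ℱ.ε⁻¹≈ε)))

        χ-eigenvector : ∀ x → cayley χ x ≈ - K * χ x
        χ-eigenvector x = [ χ-eigenvector-ker , χ-eigenvector-off-ker ]′ (toSum (φ x ≟ 0F))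

module PermutationGraph {f c ℓ} (F : FiniteField f) (R : RealClosedField c ℓ) where
  open FiniteField F using (size) renaming (0# to 0F; 1# to 1F; _+_ to _+F_; -_ to -F_)
  open RealClosedField R hiding (_≤_)
  open OrderedField R
  open FiniteSums R using (ι; ι-nonneg)
  open FieldVectors F using (coordinateDifference; coordinateDifference-⊕; coordinateDifference-⊙)
  open FiniteFieldProperties F using (index; index-0≢index-1; size≡2+)
  open PermutationVectors F
  open FieldCardinality F R using (q-1; q-1≉0)
  open CayleyGraph F R {size} (ι ∘ isPermutation)
  open ScalingInvariant (λ c≢0 σ → reflexive (≡.cong ι (isPermutation-⊙ c≢0 σ)))
  open import Algebra.Properties.Group (CommutativeRing.+-group (fieldRing F)) using (x∙y⁻¹≈ε⇒x≈y)

  i₀ i₁ : Fin size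
  i₀ = index 0F
  i₁ = index 1F

  isPermutation-ker : ∀ σ → coordinateDifference i₀ i₁ σ ≡ 0F → ι (isPermutation σ) ≈ 0#
  isPermutation-ker σ σᵢ₀-σᵢ₁≡0 with isPermutation σ in isPerm
  ... | false = refl
  ... | true  = ⊥-elim (isPermutation-injective {σ = σ} (≡.subst T (≡.sym isPerm) _) index-0≢index-1
                          (x∙y⁻¹≈ε⇒x≈y _ _ σᵢ₀-σᵢ₁≡0))

  open LinearFunctional (coordinateDifference i₀ i₁) (coordinateDifference-⊕ i₀ i₁) (coordinateDifference-⊙ i₀ i₁)
                        isPermutation-ker

  K : Carrier
  K = fromℕ (size ℕ.* (size ∸ 2) !)

  q-1*K≈size! : q-1 * K ≈ fromℕ (size !)
  q-1*K≈size! = trans (sym (fromℕ-* (size ∸ 1) _)) (reflexive (≡.cong fromℕ size-identity))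
    where
    size-identity : (size ∸ 1) ℕ.* (size ℕ.* (size ∸ 2) !) ≡ size !
    size-identity = [n∸1]*[n*[n∸2]!]≡n! (≡.subst (2 ℕ.≤_) (≡.sym (proj₂ size≡2+)) (ℕ.s≤s (ℕ.s≤s ℕ.z≤n)))

  q-1*K≈degree : q-1 * K ≈ degree
  q-1*K≈degree = trans q-1*K≈size! (sym (count-permutations R))

  -K-isEigenvalue : Omega.IsEigenvalue F R (- K)
  -K-isEigenvalue = χ , (origin , χ-origin≉0) , λ x → trans (cayley-matrix χ x) (χ-eigenvector q-1*K≈degree x)
    where
    origin : Point
    origin = Vec.replicate size 0F
    origin-ker : coordinateDifference i₀ i₁ origin ≡ 0F
    origin-ker = ≡.trans (≡.cong₂ (λ a b → a +F -F b) (Vec.lookup-replicate i₀ 0F) (Vec.lookup-replicate i₁ 0F))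
                         (CommutativeRing.-‿inverseʳ (fieldRing F) 0F)
    χ-origin≉0 : χ origin ≉ 0#
    χ-origin≉0 = q-1≉0 ∘ trans (sym (χ-ker {origin} origin-ker))

  -K-minimal : ∀ μ → Omega.IsEigenvalue F R μ → - K ≤ μ
  -K-minimal μ (v , (x₀ , vx₀≉0) , eigen) =
    0≤x+y⇒-x≤y (nonneg-*-cancelˡ (fromℕ-nonneg (size ∸ 1)) q-1≉0 0≤q-1[K+μ])
    where
    0≤q-1[K+μ] : 0# ≤ q-1 * (K + μ)
    0≤q-1[K+μ] = ≤-resp-≈ refl (trans (+-congʳ (sym q-1*K≈degree)) (sym (distribˡ q-1 K μ)))
      (eigenvalue-lower-bound (ι-nonneg ∘ isPermutation) vx₀≉0 (λ x → trans (sym (cayley-matrix v x)) (eigen x)))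

lemma4p5 : ∀ {f c ℓ} (F : FiniteField f) (R : RealClosedField c ℓ) →
           Σ (RealClosedField.Carrier R) λ lam →
             Omega.IsMinEigenvalue F R lam ×
             RealClosedField._≈_ R
               (RealClosedField._*_ R (RealClosedField.fromℕ R (FiniteField.size F ∸ 1)) lam)
               (RealClosedField.-_ R (RealClosedField.fromℕ R (FiniteField.size F !)))
lemma4p5 F R = - K , (-K-isEigenvalue , -K-minimal) , trans (sym (-‿distribʳ-* _ K)) (-‿cong q-1*K≈size!)
  where
  open PermutationGraph F R
  open RealClosedField R using (-_; trans; sym; -‿cong)
  open import Algebra.Properties.Ring (RealClosedField.ring R) using (-‿distribʳ-*)
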